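{- Let $G=(V,E)$ be a graph with weight function $\mathbf{w}:E\to\mathbb{R}_{\ge0}$, $k$ a positive integer, $\lambda>0$, $\gamma>0$ and $\rho=(1+\gamma)\lambda$. Then: (1) if $\mathsf{OPT}_{\mathbf{w}}\in[\lambda,(1+\gamma)\lambda)$, then $\mathsf{mincut}_{\mathbf{w}_\rho}\in[k\rho/(1+\gamma),k\rho)$; (2) for any cut $C$ with $\mathbf{w}_\rho(C)<k\rho$, letting $F=H_{\mathbf{w},\rho}\cap C$ be the set of $\rho$-heavy edges in $C$, we have $\mathsf{val}_{\mathbf{w}}(C,F)<(1+\gamma)\lambda$; in particular $\mathsf{val}_{\mathbf{w}}(C)<(1+\gamma)\lambda$.
   Context: A cut is an edge set $C=\delta_G(S)$, $\emptyset\ne S\subsetneq V$. For $X\subseteq E$, $\mathbf{w}(X)=\sum_{e\in X}\mathbf{w}(e)$. For a cut $C$ and $F\subseteq E$: $\mathsf{val}_{\mathbf{w}}(C,F)=\frac{\mathbf{w}(C\setminus F)}{k-|F|}$ if $F\subseteq C$ and $|F|<k$, and $\mathsf{val}_{\mathbf{w}}(C,F)=\infty$ otherwise; $\mathsf{val}_{\mathbf{w}}(C)=\min_{F\subseteq E}\mathsf{val}_{\mathbf{w}}(C,F)$; $\mathsf{OPT}_{\mathbf{w}}=\min_C\mathsf{val}_{\mathbf{w}}(C)$. The truncated weight is $\mathbf{w}_\rho(e)=\min\{\mathbf{w}(e),\rho\}$; $\mathsf{mincut}_{\mathbf{w}_\rho}=\min_C\mathbf{w}_\rho(C)$. The set of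 $\rho$-heavy edges is $H_{\mathbf{w},\rho}=\{e\in E:\mathbf{w}(e)\ge\rho\}$.
   Formalization: The edge weights and the parameters λ and γ are rational instead of real. -}

module Defs where

open import Data.Bool using (Bool; true; false; if_then_else_; not; _xor_)
open import Data.Nat as ℕ using (ℕ; zero; suc; _∸_)
open import Data.Integer using (+_)
open import Data.Fin using (Fin)
open import Data.Fin.Subset using (Subset; _─_; _∩_; ∁; ∣_∣; Nonempty)
open import Data.Fin.Subset.Properties using (nonempty?; _⊆?_)
open import Data.List using (List; []; _∷_; map; _++_; foldr; filter; allFin)
open import Data.Vec using (Vec; lookup; tabulate) renaming ([] to []ᵥ; _∷_ to _∷ᵥ_)
open import Data.Maybe using (Maybe; just; nothing)
open import Data.Product using (_×_; _,_; proj₁; proj₂)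
open import Data.Unit using (⊤)
open import Data.Empty using (⊥)
open import Data.Rational using (ℚ; 0ℚ; 1ℚ; _+_; _*_; _/_; _⊓_; _≤_; _<_; NonZero; >-nonZero)
open import Data.Rational.Properties using (_≤?_; +-mono-<)
open import Relation.Nullary using (does; yes; no)
open import Relation.Nullary.Decidable using (_×-dec_)

-- Extended nonnegative values: nothing = ∞
ℚ∞ : Set
ℚ∞ = Maybe ℚ

_⊓∞_ : ℚ∞ → ℚ∞ → ℚ∞
nothing ⊓∞ y = y
just x ⊓∞ nothing = just x
just x ⊓∞ just y = just (x ⊓ y)

min∞ : List ℚ∞ → ℚ∞
min∞ = foldr _⊓∞_ nothing

_≤∞_ : ℚ → ℚ∞ → Set
q ≤∞ nothing = ⊤
q ≤∞ just x = q ≤ x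

_<∞_ : ℚ∞ → ℚ → Set
nothing <∞ q = ⊥
just x <∞ q = x < q

allSubsets : (n : ℕ) → List (Subset n)
allSubsets zero = []ᵥ ∷ []
allSubsets (suc n) = map (true ∷ᵥ_) (allSubsets n) ++ map (false ∷ᵥ_) (allSubsets n)

-- A (multi)graph on vertex set Fin n with edge set Fin m; ends e = endpoints of e
Graph : ℕ → ℕ → Set
Graph n m = Fin m → Fin n × Fin n

δ : ∀ {n m} → Graph n m → Subset n → Subset m
δ G S = tabulate λ e → lookup S (proj₁ (G e)) xor lookup S (proj₂ (G e))

ProperSide : ∀ {n} → Subset n → Set
ProperSide S = Nonempty S × Nonempty (∁ S)

cuts : ∀ {n m} → Graph n m → List (Subset m)
cuts {n} G = map (δ G) (filter (λ S → nonempty? S ×-dec nonempty? (∁ S)) (allSubsets n))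

sumℚ : List ℚ → ℚ
sumℚ = foldr _+_ 0ℚ

wt : ∀ {m} → (Fin m → ℚ) → Subset m → ℚ
wt {m} w X = sumℚ (map (λ e → if lookup X e then w e else 0ℚ) (allFin m))

valF : ∀ {m} → (Fin m → ℚ) → ℕ → Subset m → Subset m → ℚ∞
valF w k C F with does (F ⊆? C) | k ∸ ∣ F ∣
... | false | _ = nothing
... | true | zero = nothing
... | true | suc j = just (wt w (C ─ F) * ((+ 1) / suc j))

val : ∀ {m} → (Fin m → ℚ) → ℕ → Subset m → ℚ∞
val {m} w k C = min∞ (map (valF w k C) (allSubsets m))

OPT : ∀ {n m} → Graph n m → (Fin m → ℚ) → ℕ → ℚ∞
OPT G w k = min∞ (map (val w k) (cuts G))

trunc : ∀ {m} → (Fin m → ℚ) → ℚ → Fin m → ℚ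
trunc w ρ e = w e ⊓ ρ

mincut : ∀ {n m} → Graph n m → (Fin m → ℚ) → ℚ∞
mincut G w = min∞ (map (λ C → just (wt w C)) (cuts G))

heavy : ∀ {m} → (Fin m → ℚ) → ℚ → Subset m
heavy w ρ = tabulate λ e → does (ρ ≤? w e)

ℕ→ℚ : ℕ → ℚ
ℕ→ℚ k = (+ k) / 1

1+γ-pos : ∀ {γ} → 0ℚ < γ → 0ℚ < 1ℚ + γ
1+γ-pos γ>0 = +-mono-< (Data.Rational.Properties.positive⁻¹ 1ℚ) γ>0

1+γ-nz : ∀ {γ} → 0ℚ < γ → NonZero (1ℚ + γ)
1+γ-nz γ>0 = >-nonZero (1+γ-pos γ>0)

{-# OPTIONS --safe #-}
module Submission where

-- Let F = H ∩ C be the ρ-heavy part of a cut C.  Truncation at ρ gives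
-- w_ρ(C) = w(C ∖ F) + |F| ρ, and w_ρ(C) ≤ w(C ∖ F') + |F'| ρ for every F' ⊆ C.
-- As val(C, F') < ρ says exactly that |F'| < k and w(C ∖ F') < (k − |F'|) ρ,
-- the inequality turns any F' with val(C, F') < ρ into w_ρ(C) < kρ, and the
-- equality turns w_ρ(C) < kρ into val(C, F) < ρ (w ≥ 0 rules out |F| ≥ k).
-- Conversely val(C, F) ≥ λ gives w(C ∖ F) ≥ (k − |F|) λ and hence, as λ ≤ ρ,
-- w_ρ(C) ≥ kλ = kρ / (1 + γ); if |F| ≥ k then already w_ρ(C) ≥ |F| ρ ≥ kλ.

open import Defs
open import Data.Bool using (true; false; if_then_else_; _∧_)
open import Data.Nat using (ℕ; _≤_)
import Data.Nat as ℕ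
import Data.Nat.Properties as ℕ
import Data.Nat.Coprimality as Coprime
open import Data.Integer as ℤ using (1ℤ)
import Data.Integer.Properties as ℤ
open import Data.Rational as Q using (ℚ; mkℚ; 0ℚ; 1ℚ; _+_; _*_; _÷_; _<_; _/_; _⊓_; Positive; NonNegative; nonNegative)
open import Data.Rational.Properties
open import Data.Rational.Solver using (module +-*-Solver)
open import Data.Fin using (Fin; zero; suc)
open import Data.Fin.Subset using (Subset; _∩_; _─_; ∣_∣; _⊆_)
open import Data.Fin.Subset.Properties using (_⊆?_; p∩q⊆q)
open import Data.Vec using (lookup) renaming ([] to []ᵥ; _∷_ to _∷ᵥ_)
open import Data.Vec.Properties using (lookup-zipWith; lookup∘tabulate; []=⇒lookup; lookup⇒[]=)
open import Data.List using ([]; _∷_; map; allFin)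
open import Data.List.Properties using (map-cong; map-tabulate)
open import Data.List.Membership.Propositional using (_∈_; find; lose)
open import Data.List.Membership.Propositional.Properties using (∈-map⁺; ∈-++⁺ˡ; ∈-++⁺ʳ)
open import Data.List.Relation.Unary.Any as Any using (Any; here; there; satisfied)
open import Data.List.Relation.Unary.All as All using (All; []; _∷_)
import Data.List.Relation.Unary.Any.Properties as Any
import Data.List.Relation.Unary.All.Properties as All
open import Data.Product using (_×_; _,_; ∃)
open import Data.Sum using (_⊎_; inj₁; inj₂)
open import Data.Unit using (tt)
open import Data.Empty using (⊥-elim)
open import Data.Maybe using (just; nothing)
open import Relation.Nullary using (¬_; Dec; yes; no; does)
open import Relation.Binary.PropositionalEquality

<⇒≱ : ∀ {p q} → p < q → ¬ (q Q.≤ p)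
<⇒≱ p<q q≤p = <-irrefl refl (<-≤-trans p<q q≤p)

p≤q+p : ∀ {p q} → 0ℚ Q.≤ q → p Q.≤ q + p
p≤q+p {p} {q} 0≤q = subst (Q._≤ q + p) (+-identityˡ p) (+-monoˡ-≤ p 0≤q)

p≤[1+q]*p : ∀ {p q} → 0ℚ Q.≤ p → 0ℚ Q.≤ q → p Q.≤ (1ℚ + q) * p
p≤[1+q]*p {p} {q} 0≤p 0≤q = begin
  p               ≤⟨ p≤q+p (subst (Q._≤ q * p) (*-zeroˡ p) (*-monoʳ-≤-nonNeg p {{nonNegative 0≤p}} 0≤q)) ⟩
  q * p + p       ≡⟨ +-comm (q * p) p ⟩
  p + q * p       ≡⟨ cong (_+ q * p) (sym (*-identityˡ p)) ⟩
  1ℚ * p + q * p  ≡⟨ sym (*-distribʳ-+ p 1ℚ q) ⟩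
  (1ℚ + q) * p    ∎
  where open ≤-Reasoning

p*[r*q]÷r≡p*q : ∀ p q r .{{_ : Q.NonZero r}} → (p * (r * q)) ÷ r ≡ p * q
p*[r*q]÷r≡p*q p q r = begin
  (p * (r * q)) * Q.1/ r  ≡⟨ solve 4 (λ p q r s → (p :* (r :* q)) :* s := (p :* q) :* (r :* s)) refl p q r (Q.1/ r) ⟩
  (p * q) * (r * Q.1/ r)  ≡⟨ cong ((p * q) *_) (*-inverseʳ r) ⟩
  (p * q) * 1ℚ            ≡⟨ *-identityʳ (p * q) ⟩
  p * q                   ∎
  where open ≡-Reasoning; open +-*-Solver

ℕ→ℚ-mkℚ : ∀ n → ℕ→ℚ n ≡ mkℚ (ℤ.+ n) 0 (Coprime.sym (Coprime.1-coprimeTo n))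
ℕ→ℚ-mkℚ n = normalize-coprime (Coprime.sym (Coprime.1-coprimeTo n))

-- On coprime normal forms _+_ computes to (a * 1 + b * 1) / (1 * 1).
ℕ→ℚ-+ : ∀ a b → ℕ→ℚ (a ℕ.+ b) ≡ ℕ→ℚ a + ℕ→ℚ b
ℕ→ℚ-+ a b rewrite ℕ→ℚ-mkℚ a | ℕ→ℚ-mkℚ b =
  cong₂ (λ x y → (x ℤ.+ y) / 1) (sym (ℤ.*-identityʳ (ℤ.+ a))) (sym (ℤ.*-identityʳ (ℤ.+ b)))

ℕ→ℚ-pos : ∀ n .{{_ : ℕ.NonZero n}} → Positive (ℕ→ℚ n)
ℕ→ℚ-pos n = normalize-pos n 1

ℕ→ℚ-nonNeg : ∀ n → NonNegative (ℕ→ℚ n)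
ℕ→ℚ-nonNeg n = normalize-nonNeg n 1

ℕ→ℚ-mono-≤ : ∀ {a b} → a ℕ.≤ b → ℕ→ℚ a Q.≤ ℕ→ℚ b
ℕ→ℚ-mono-≤ {a} {b} a≤b = begin
  ℕ→ℚ a                  ≤⟨ p≤q+p (nonNegative⁻¹ (ℕ→ℚ (b ℕ.∸ a)) {{ℕ→ℚ-nonNeg (b ℕ.∸ a)}}) ⟩
  ℕ→ℚ (b ℕ.∸ a) + ℕ→ℚ a  ≡⟨ sym (ℕ→ℚ-+ (b ℕ.∸ a) a) ⟩
  ℕ→ℚ (b ℕ.∸ a ℕ.+ a)    ≡⟨ cong ℕ→ℚ (ℕ.m∸n+n≡m a≤b) ⟩
  ℕ→ℚ b                  ∎
  where open ≤-Reasoning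

ℕ→ℚ-∸-+ : ∀ {n k} → n ℕ.≤ k → ∀ q → ℕ→ℚ (k ℕ.∸ n) * q + ℕ→ℚ n * q ≡ ℕ→ℚ k * q
ℕ→ℚ-∸-+ {n} {k} n≤k q = begin
  ℕ→ℚ (k ℕ.∸ n) * q + ℕ→ℚ n * q  ≡⟨ sym (*-distribʳ-+ q (ℕ→ℚ (k ℕ.∸ n)) (ℕ→ℚ n)) ⟩
  (ℕ→ℚ (k ℕ.∸ n) + ℕ→ℚ n) * q    ≡⟨ cong (_* q) (sym (ℕ→ℚ-+ (k ℕ.∸ n) n)) ⟩
  ℕ→ℚ (k ℕ.∸ n ℕ.+ n) * q        ≡⟨ cong (λ x → ℕ→ℚ x * q) (ℕ.m∸n+n≡m n≤k) ⟩
  ℕ→ℚ k * q                      ∎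
  where open ≡-Reasoning

ℕ→ℚ-inverseʳ : ∀ d .{{_ : ℕ.NonZero d}} → ℕ→ℚ d * (1ℤ / d) ≡ 1ℚ
ℕ→ℚ-inverseʳ (ℕ.suc j) rewrite ℕ→ℚ-mkℚ (ℕ.suc j) | normalize-coprime {1} {j} (Coprime.1-coprimeTo (ℕ.suc j)) =
  *-inverseʳ (mkℚ (ℤ.+ ℕ.suc j) 0 (Coprime.sym (Coprime.1-coprimeTo (ℕ.suc j))))

module _ (d : ℕ) .{{_ : ℕ.NonZero d}} {x q : ℚ} where
  private
    instance
      d-pos : Positive (ℕ→ℚ d)
      d-pos = ℕ→ℚ-pos d
      1/d-pos : Positive (1ℤ / d)
      1/d-pos = normalize-pos 1 d

    d*[p*r]≡p*[d*r] : ∀ p r → ℕ→ℚ d * (p * r) ≡ p * (ℕ→ℚ d * r)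
    d*[p*r]≡p*[d*r] = solve 3 (λ s p r → s :* (p :* r) := p :* (s :* r)) refl (ℕ→ℚ d)
      where open +-*-Solver

    d*[p*1/d]≡p : ∀ p → ℕ→ℚ d * (p * (1ℤ / d)) ≡ p
    d*[p*1/d]≡p p = trans (d*[p*r]≡p*[d*r] p _) (trans (cong (p *_) (ℕ→ℚ-inverseʳ d)) (*-identityʳ p))

    [d*p]*1/d≡p : ∀ p → (ℕ→ℚ d * p) * (1ℤ / d) ≡ p
    [d*p]*1/d≡p p = trans (*-assoc (ℕ→ℚ d) p _) (d*[p*1/d]≡p p)

  x*1/d<q⇒x<d*q : x * (1ℤ / d) < q → x < ℕ→ℚ d * q
  x*1/d<q⇒x<d*q h = subst (_< ℕ→ℚ d * q) (d*[p*1/d]≡p x) (*-monoʳ-<-pos (ℕ→ℚ d) h)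

  x<d*q⇒x*1/d<q : x < ℕ→ℚ d * q → x * (1ℤ / d) < q
  x<d*q⇒x*1/d<q h = subst (x * (1ℤ / d) <_) ([d*p]*1/d≡p q) (*-monoˡ-<-pos (1ℤ / d) h)

  q≤x*1/d⇒d*q≤x : q Q.≤ x * (1ℤ / d) → ℕ→ℚ d * q Q.≤ x
  q≤x*1/d⇒d*q≤x h = subst (ℕ→ℚ d * q Q.≤_) (d*[p*1/d]≡p x) (*-monoˡ-≤-nonNeg (ℕ→ℚ d) {{pos⇒nonNeg (ℕ→ℚ d)}} h)

⊓∞-<∞ˡ : ∀ {a} b {q} → a <∞ q → (a ⊓∞ b) <∞ q
⊓∞-<∞ˡ {just x} nothing  h = h
⊓∞-<∞ˡ {just x} (just y) h = ≤-<-trans (p⊓q≤p x y) h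

⊓∞-<∞ʳ : ∀ a {b q} → b <∞ q → (a ⊓∞ b) <∞ q
⊓∞-<∞ʳ nothing          h = h
⊓∞-<∞ʳ (just x) {just y} h = ≤-<-trans (p⊓q≤q x y) h

⊓∞-<∞⁻ : ∀ a b {q} → (a ⊓∞ b) <∞ q → a <∞ q ⊎ b <∞ q
⊓∞-<∞⁻ nothing  b        h = inj₂ h
⊓∞-<∞⁻ (just x) nothing  h = inj₁ h
⊓∞-<∞⁻ (just x) (just y) h with ⊓-sel x y
... | inj₁ x⊓y≡x = inj₁ (subst (_< _) x⊓y≡x h)
... | inj₂ x⊓y≡y = inj₂ (subst (_< _) x⊓y≡y h)

≤∞-⊓∞⁺ : ∀ a b {q} → q ≤∞ a → q ≤∞ b → q ≤∞ (a ⊓∞ b)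
≤∞-⊓∞⁺ nothing  b        _   h   = h
≤∞-⊓∞⁺ (just x) nothing  h   _   = h
≤∞-⊓∞⁺ (just x) (just y) q≤x q≤y = ⊓-glb q≤x q≤y

≤∞-⊓∞⁻ : ∀ a b {q} → q ≤∞ (a ⊓∞ b) → q ≤∞ a × q ≤∞ b
≤∞-⊓∞⁻ nothing  b        h = tt , h
≤∞-⊓∞⁻ (just x) nothing  h = h , tt
≤∞-⊓∞⁻ (just x) (just y) h = ≤-trans h (p⊓q≤p x y) , ≤-trans h (p⊓q≤q x y)

min∞-<∞⁺ : ∀ {q xs} → Any (_<∞ q) xs → min∞ xs <∞ q
min∞-<∞⁺ {xs = x ∷ xs} (here h)  = ⊓∞-<∞ˡ (min∞ xs) h
min∞-<∞⁺ {xs = x ∷ xs} (there h) = ⊓∞-<∞ʳ x (min∞-<∞⁺ h)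

min∞-<∞⁻ : ∀ {q} xs → min∞ xs <∞ q → Any (_<∞ q) xs
min∞-<∞⁻ (x ∷ xs) h with ⊓∞-<∞⁻ x (min∞ xs) h
... | inj₁ hx  = here hx
... | inj₂ hxs = there (min∞-<∞⁻ xs hxs)

≤∞-min∞⁺ : ∀ {q xs} → All (q ≤∞_) xs → q ≤∞ min∞ xs
≤∞-min∞⁺ []       = tt
≤∞-min∞⁺ (h ∷ hs) = ≤∞-⊓∞⁺ _ _ h (≤∞-min∞⁺ hs)

≤∞-min∞⁻ : ∀ {q} xs → q ≤∞ min∞ xs → All (q ≤∞_) xs
≤∞-min∞⁻ []       _ = []
≤∞-min∞⁻ (x ∷ xs) h = let hx , hxs = ≤∞-⊓∞⁻ x (min∞ xs) h in hx ∷ ≤∞-min∞⁻ xs hxs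

∈-allSubsets : ∀ {m} (p : Subset m) → p ∈ allSubsets m
∈-allSubsets []ᵥ                   = here refl
∈-allSubsets (true ∷ᵥ p)           = ∈-++⁺ˡ (∈-map⁺ (true ∷ᵥ_) (∈-allSubsets p))
∈-allSubsets {ℕ.suc m} (false ∷ᵥ p) =
  ∈-++⁺ʳ (map (true ∷ᵥ_) (allSubsets m)) (∈-map⁺ (false ∷ᵥ_) (∈-allSubsets p))

sumℚ-map-+ : ∀ {A : Set} (f g : A → ℚ) xs →
  sumℚ (map (λ x → f x + g x) xs) ≡ sumℚ (map f xs) + sumℚ (map g xs)
sumℚ-map-+ f g []       = refl
sumℚ-map-+ f g (x ∷ xs) = begin
  (f x + g x) + sumℚ (map (λ x → f x + g x) xs)      ≡⟨ cong ((f x + g x) +_) (sumℚ-map-+ f g xs) ⟩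
  (f x + g x) + (sumℚ (map f xs) + sumℚ (map g xs))  ≡⟨ interchange (f x) (g x) _ _ ⟩
  (f x + sumℚ (map f xs)) + (g x + sumℚ (map g xs))  ∎
  where
  open ≡-Reasoning
  interchange : ∀ a b c d → (a + b) + (c + d) ≡ (a + c) + (b + d)
  interchange = solve 4 (λ a b c d → (a :+ b) :+ (c :+ d) := (a :+ c) :+ (b :+ d)) refl
    where open +-*-Solver

sumℚ-map-mono-≤ : ∀ {A : Set} {f g : A → ℚ} → (∀ x → f x Q.≤ g x) → ∀ xs → sumℚ (map f xs) Q.≤ sumℚ (map g xs)
sumℚ-map-mono-≤ f≤g []       = ≤-refl
sumℚ-map-mono-≤ f≤g (x ∷ xs) = +-mono-≤ (f≤g x) (sumℚ-map-mono-≤ f≤g xs)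

sumℚ-nonNeg : ∀ {xs} → All (0ℚ Q.≤_) xs → 0ℚ Q.≤ sumℚ xs
sumℚ-nonNeg []       = ≤-refl
sumℚ-nonNeg (h ∷ hs) = +-mono-≤ h (sumℚ-nonNeg hs)

-- wt w X is definitionally sumℚ (map (w ↾ X) (allFin m)).
_↾_ : ∀ {m} → (Fin m → ℚ) → Subset m → Fin m → ℚ
(w ↾ X) e = if lookup X e then w e else 0ℚ

wt-≤-+ : ∀ {m} (u v t : Fin m → ℚ) (X Y Z : Subset m) →
  (∀ e → (u ↾ X) e Q.≤ (v ↾ Y) e + (t ↾ Z) e) → wt u X Q.≤ wt v Y + wt t Z
wt-≤-+ {m} u v t X Y Z h =
  ≤-trans (sumℚ-map-mono-≤ h (allFin m)) (≤-reflexive (sumℚ-map-+ (v ↾ Y) (t ↾ Z) (allFin m)))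

wt-≡-+ : ∀ {m} (u v t : Fin m → ℚ) (X Y Z : Subset m) →
  (∀ e → (u ↾ X) e ≡ (v ↾ Y) e + (t ↾ Z) e) → wt u X ≡ wt v Y + wt t Z
wt-≡-+ {m} u v t X Y Z h =
  trans (cong sumℚ (map-cong h (allFin m))) (sumℚ-map-+ (v ↾ Y) (t ↾ Z) (allFin m))

wt-nonNeg : ∀ {m} {w : Fin m → ℚ} → (∀ e → 0ℚ Q.≤ w e) → ∀ X → 0ℚ Q.≤ wt w X
wt-nonNeg {m} {w} w≥0 X = sumℚ-nonNeg (All.map⁺ (All.universal summand-nonNeg (allFin m)))
  where
  summand-nonNeg : ∀ e → 0ℚ Q.≤ (w ↾ X) e
  summand-nonNeg e with lookup X e
  ... | true  = w≥0 e
  ... | false = ≤-refl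

wt-∷ : ∀ {m} (w : Fin (ℕ.suc m) → ℚ) b X → wt w (b ∷ᵥ X) ≡ (if b then w zero else 0ℚ) + wt (λ e → w (suc e)) X
wt-∷ w b X = cong (λ s → (if b then w zero else 0ℚ) + sumℚ s)
  (trans (map-tabulate suc (w ↾ (b ∷ᵥ X))) (sym (map-tabulate (λ e → e) (λ e → (w ↾ (b ∷ᵥ X)) (suc e)))))

wt-const : ∀ {m} q (X : Subset m) → wt (λ _ → q) X ≡ ℕ→ℚ ∣ X ∣ * q
wt-const q []ᵥ          = sym (*-zeroˡ q)
wt-const q (false ∷ᵥ X) = trans (wt-∷ (λ _ → q) false X) (trans (+-identityˡ _) (wt-const q X))
wt-const q (true ∷ᵥ X)  = begin
  wt (λ _ → q) (true ∷ᵥ X)  ≡⟨ wt-∷ (λ _ → q) true X ⟩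
  q + wt (λ _ → q) X        ≡⟨ cong₂ _+_ (sym (*-identityˡ q)) (wt-const q X) ⟩
  1ℚ * q + ℕ→ℚ ∣ X ∣ * q    ≡⟨ sym (*-distribʳ-+ q 1ℚ (ℕ→ℚ ∣ X ∣)) ⟩
  (1ℚ + ℕ→ℚ ∣ X ∣) * q      ≡⟨ cong (_* q) (sym (ℕ→ℚ-+ 1 ∣ X ∣)) ⟩
  ℕ→ℚ (ℕ.suc ∣ X ∣) * q     ∎
  where open ≡-Reasoning

lookup-─ : ∀ {m} (p q : Subset m) i → lookup (p ─ q) i ≡ (if lookup q i then false else lookup p i)
lookup-─ (x ∷ᵥ p) (true  ∷ᵥ q) zero    = refl
lookup-─ (x ∷ᵥ p) (false ∷ᵥ q) zero    = refl
lookup-─ (x ∷ᵥ p) (y ∷ᵥ q)     (suc i) = lookup-─ p q i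

module _ {m} (w : Fin m → ℚ) (ρ : ℚ) where

  wt-trunc-≤ : ∀ {C F : Subset m} → F ⊆ C → wt (trunc w ρ) C Q.≤ wt w (C ─ F) + ℕ→ℚ ∣ F ∣ * ρ
  wt-trunc-≤ {C} {F} F⊆C = begin
    wt (trunc w ρ) C               ≤⟨ wt-≤-+ (trunc w ρ) w (λ _ → ρ) C (C ─ F) F summand-≤ ⟩
    wt w (C ─ F) + wt (λ _ → ρ) F  ≡⟨ cong (wt w (C ─ F) +_) (wt-const ρ F) ⟩
    wt w (C ─ F) + ℕ→ℚ ∣ F ∣ * ρ   ∎
    where
    open ≤-Reasoning
    split-≤ : ∀ a c f → (f ≡ true → c ≡ true) →
      (if c then a ⊓ ρ else 0ℚ) Q.≤ (if (if f then false else c) then a else 0ℚ) + (if f then ρ else 0ℚ)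
    split-≤ a true  true  _ = subst (a ⊓ ρ Q.≤_) (sym (+-identityˡ ρ)) (p⊓q≤q a ρ)
    split-≤ a true  false _ = subst (a ⊓ ρ Q.≤_) (sym (+-identityʳ a)) (p⊓q≤p a ρ)
    split-≤ a false false _ = ≤-refl
    split-≤ a false true  f⇒c with () ← f⇒c refl
    summand-≤ : ∀ e → (trunc w ρ ↾ C) e Q.≤ (w ↾ (C ─ F)) e + ((λ _ → ρ) ↾ F) e
    summand-≤ e rewrite lookup-─ C F e =
      split-≤ (w e) (lookup C e) (lookup F e) (λ Fe → []=⇒lookup (F⊆C (lookup⇒[]= e F Fe)))

  wt-trunc-heavy : ∀ (C : Subset m) → wt (trunc w ρ) C ≡ wt w (C ─ (heavy w ρ ∩ C)) + ℕ→ℚ ∣ heavy w ρ ∩ C ∣ * ρ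
  wt-trunc-heavy C = begin
    wt (trunc w ρ) C               ≡⟨ wt-≡-+ (trunc w ρ) w (λ _ → ρ) C (C ─ F) F summand-≡ ⟩
    wt w (C ─ F) + wt (λ _ → ρ) F  ≡⟨ cong (wt w (C ─ F) +_) (wt-const ρ F) ⟩
    wt w (C ─ F) + ℕ→ℚ ∣ F ∣ * ρ   ∎
    where
    open ≡-Reasoning
    F = heavy w ρ ∩ C
    split-≡ : ∀ a c (h : Dec (ρ Q.≤ a)) → (if c then a ⊓ ρ else 0ℚ) ≡
      (if (if does h ∧ c then false else c) then a else 0ℚ) + (if does h ∧ c then ρ else 0ℚ)
    split-≡ a true  (yes ρ≤a) = trans (p≥q⇒p⊓q≡q ρ≤a) (sym (+-identityˡ ρ))
    split-≡ a true  (no ρ≰a)  = trans (p≤q⇒p⊓q≡p (<⇒≤ (≰⇒> ρ≰a))) (sym (+-identityʳ a))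
    split-≡ a false (yes _)   = refl
    split-≡ a false (no _)    = refl
    summand-≡ : ∀ e → (trunc w ρ ↾ C) e ≡ (w ↾ (C ─ F)) e + ((λ _ → ρ) ↾ F) e
    summand-≡ e rewrite lookup-─ C F e | lookup-zipWith _∧_ e (heavy w ρ) C
                      | lookup∘tabulate (λ e → does (ρ ≤? w e)) e =
      split-≡ (w e) (lookup C e) (ρ ≤? w e)

module _ {m} (w : Fin m → ℚ) (k : ℕ) (C F : Subset m) where

  valF-<∞⁻ : ∀ {q} → valF w k C F <∞ q →
    F ⊆ C × ∣ F ∣ ℕ.< k × wt w (C ─ F) < ℕ→ℚ (k ℕ.∸ ∣ F ∣) * q
  valF-<∞⁻ h with F ⊆? C | k ℕ.∸ ∣ F ∣ in k∸∣F∣≡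
  valF-<∞⁻ () | no _    | _
  valF-<∞⁻ () | yes _   | 0
  valF-<∞⁻ h  | yes F⊆C | ℕ.suc d =
    F⊆C , ℕ.m∸n≢0⇒n<m (λ k∸∣F∣≡0 → ℕ.1+n≢0 (trans (sym k∸∣F∣≡) k∸∣F∣≡0)) , x*1/d<q⇒x<d*q (ℕ.suc d) h

  valF-<∞⁺ : ∀ {q} → F ⊆ C → ∣ F ∣ ℕ.< k →
    wt w (C ─ F) < ℕ→ℚ (k ℕ.∸ ∣ F ∣) * q → valF w k C F <∞ q
  valF-<∞⁺ F⊆C ∣F∣<k h with F ⊆? C | k ℕ.∸ ∣ F ∣ in k∸∣F∣≡
  ... | no F⊈C | _       = F⊈C F⊆C
  ... | yes _  | 0       = ℕ.m>n⇒m∸n≢0 ∣F∣<k k∸∣F∣≡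
  ... | yes _  | ℕ.suc d = x<d*q⇒x*1/d<q (ℕ.suc d) h

  valF-≤∞⁻ : ∀ {q} → q ≤∞ valF w k C F → F ⊆ C → ∣ F ∣ ℕ.< k →
    ℕ→ℚ (k ℕ.∸ ∣ F ∣) * q Q.≤ wt w (C ─ F)
  valF-≤∞⁻ h F⊆C ∣F∣<k with F ⊆? C | k ℕ.∸ ∣ F ∣ in k∸∣F∣≡
  ... | no F⊈C | _       = ⊥-elim (F⊈C F⊆C)
  ... | yes _  | 0       = ⊥-elim (ℕ.m>n⇒m∸n≢0 ∣F∣<k k∸∣F∣≡)
  ... | yes _  | ℕ.suc d = q≤x*1/d⇒d*q≤x (ℕ.suc d) h

valF<∞⇒wt-trunc<k*ρ : ∀ {m} {w : Fin m → ℚ} {k ρ C} F → valF w k C F <∞ ρ → wt (trunc w ρ) C < ℕ→ℚ k * ρ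
valF<∞⇒wt-trunc<k*ρ {w = w} {k} {ρ} {C} F h with valF-<∞⁻ w k C F h
... | F⊆C , ∣F∣<k , A<[k-∣F∣]*ρ = begin-strict
  wt (trunc w ρ) C                       ≤⟨ wt-trunc-≤ w ρ F⊆C ⟩
  wt w (C ─ F) + ℕ→ℚ ∣ F ∣ * ρ           <⟨ +-monoˡ-< (ℕ→ℚ ∣ F ∣ * ρ) A<[k-∣F∣]*ρ ⟩
  ℕ→ℚ (k ℕ.∸ ∣ F ∣) * ρ + ℕ→ℚ ∣ F ∣ * ρ  ≡⟨ ℕ→ℚ-∸-+ (ℕ.<⇒≤ ∣F∣<k) ρ ⟩
  ℕ→ℚ k * ρ                              ∎
  where open ≤-Reasoning

module _ {m} {w : Fin m → ℚ} (w≥0 : ∀ e → 0ℚ Q.≤ w e) {k : ℕ} {ρ : ℚ} (ρ≥0 : 0ℚ Q.≤ ρ)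
         (C : Subset m) where
  private
    F = heavy w ρ ∩ C

    wt-trunc-heavy˘ : wt w (C ─ F) + ℕ→ℚ ∣ F ∣ * ρ ≡ wt (trunc w ρ) C
    wt-trunc-heavy˘ = sym (wt-trunc-heavy w ρ C)

  k≤∣heavy∣⇒k*ρ≤wt-trunc : k ℕ.≤ ∣ F ∣ → ℕ→ℚ k * ρ Q.≤ wt (trunc w ρ) C
  k≤∣heavy∣⇒k*ρ≤wt-trunc k≤∣F∣ = begin
    ℕ→ℚ k * ρ                     ≤⟨ *-monoʳ-≤-nonNeg ρ {{nonNegative ρ≥0}} (ℕ→ℚ-mono-≤ k≤∣F∣) ⟩
    ℕ→ℚ ∣ F ∣ * ρ                 ≤⟨ p≤q+p (wt-nonNeg w≥0 (C ─ F)) ⟩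
    wt w (C ─ F) + ℕ→ℚ ∣ F ∣ * ρ  ≡⟨ wt-trunc-heavy˘ ⟩
    wt (trunc w ρ) C              ∎
    where open ≤-Reasoning

  wt-trunc<k*ρ⇒valF-heavy<∞ρ : wt (trunc w ρ) C < ℕ→ℚ k * ρ → valF w k C F <∞ ρ
  wt-trunc<k*ρ⇒valF-heavy<∞ρ h = valF-<∞⁺ w k C F (p∩q⊆q (heavy w ρ) C) ∣F∣<k (≰⇒> [k-∣F∣]*ρ≰A)
    where
    ∣F∣<k : ∣ F ∣ ℕ.< k
    ∣F∣<k = ℕ.≰⇒> (λ k≤∣F∣ → <⇒≱ h (k≤∣heavy∣⇒k*ρ≤wt-trunc k≤∣F∣))
    [k-∣F∣]*ρ≰A : ¬ (ℕ→ℚ (k ℕ.∸ ∣ F ∣) * ρ Q.≤ wt w (C ─ F))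
    [k-∣F∣]*ρ≰A [k-∣F∣]*ρ≤A = <⇒≱ h (begin
      ℕ→ℚ k * ρ                              ≡⟨ ℕ→ℚ-∸-+ (ℕ.<⇒≤ ∣F∣<k) ρ ⟨
      ℕ→ℚ (k ℕ.∸ ∣ F ∣) * ρ + ℕ→ℚ ∣ F ∣ * ρ  ≤⟨ +-monoˡ-≤ (ℕ→ℚ ∣ F ∣ * ρ) [k-∣F∣]*ρ≤A ⟩
      wt w (C ─ F) + ℕ→ℚ ∣ F ∣ * ρ           ≡⟨ wt-trunc-heavy˘ ⟩
      wt (trunc w ρ) C                       ∎)
      where open ≤-Reasoning

  ≤∞valF-heavy⇒k*q≤wt-trunc : ∀ {q} → q Q.≤ ρ → q ≤∞ valF w k C F → ℕ→ℚ k * q Q.≤ wt (trunc w ρ) C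
  ≤∞valF-heavy⇒k*q≤wt-trunc {q} q≤ρ h with ∣ F ∣ ℕ.<? k
  ... | no ∣F∣≮k = ≤-trans (*-monoˡ-≤-nonNeg (ℕ→ℚ k) {{ℕ→ℚ-nonNeg k}} q≤ρ)
                           (k≤∣heavy∣⇒k*ρ≤wt-trunc (ℕ.≮⇒≥ ∣F∣≮k))
  ... | yes ∣F∣<k = begin
    ℕ→ℚ k * q                              ≡⟨ ℕ→ℚ-∸-+ (ℕ.<⇒≤ ∣F∣<k) q ⟨
    ℕ→ℚ (k ℕ.∸ ∣ F ∣) * q + ℕ→ℚ ∣ F ∣ * q  ≤⟨ +-mono-≤ (valF-≤∞⁻ w k C F h (p∩q⊆q (heavy w ρ) C) ∣F∣<k)
                                                        (*-monoˡ-≤-nonNeg (ℕ→ℚ ∣ F ∣) {{ℕ→ℚ-nonNeg ∣ F ∣}} q≤ρ) ⟩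
    wt w (C ─ F) + ℕ→ℚ ∣ F ∣ * ρ           ≡⟨ wt-trunc-heavy˘ ⟩
    wt (trunc w ρ) C                       ∎
    where open ≤-Reasoning

module _ {m} {w : Fin m → ℚ} {k : ℕ} {C : Subset m} {q : ℚ} where

  valF<∞⇒val<∞ : ∀ {F} → valF w k C F <∞ q → val w k C <∞ q
  valF<∞⇒val<∞ {F} h = min∞-<∞⁺ {xs = map (valF w k C) (allSubsets m)} (Any.map⁺ (lose (∈-allSubsets F) h))

  val<∞⇒valF<∞ : val w k C <∞ q → ∃ λ F → valF w k C F <∞ q
  val<∞⇒valF<∞ h = satisfied (Any.map⁻ (min∞-<∞⁻ (map (valF w k C) (allSubsets m)) h))

  ≤∞val⇒≤∞valF : ∀ F → q ≤∞ val w k C → q ≤∞ valF w k C F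
  ≤∞val⇒≤∞valF F h = All.lookup (All.map⁻ (≤∞-min∞⁻ (map (valF w k C) (allSubsets m)) h)) (∈-allSubsets F)

module _ {n m} (G : Graph n m) where

  OPT<∞⇒∃cut : ∀ {w k q} → OPT G w k <∞ q → ∃ λ C → C ∈ cuts G × val w k C <∞ q
  OPT<∞⇒∃cut {w} {k} h = find (Any.map⁻ (min∞-<∞⁻ (map (val w k) (cuts G)) h))

  ≤∞OPT⇒≤∞val : ∀ {w k q C} → q ≤∞ OPT G w k → C ∈ cuts G → q ≤∞ val w k C
  ≤∞OPT⇒≤∞val {w} {k} h = All.lookup (All.map⁻ (≤∞-min∞⁻ (map (val w k) (cuts G)) h))

  cut<⇒mincut<∞ : ∀ {w q C} → C ∈ cuts G → wt w C < q → mincut G w <∞ q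
  cut<⇒mincut<∞ C∈ h = min∞-<∞⁺ (Any.map⁺ (lose C∈ h))

  ≤cuts⇒≤∞mincut : ∀ {w q} → (∀ {C} → C ∈ cuts G → q Q.≤ wt w C) → q ≤∞ mincut G w
  ≤cuts⇒≤∞mincut h = ≤∞-min∞⁺ (All.map⁺ (All.tabulate h))

OPT<∞ρ⇒mincut-trunc<∞k*ρ : ∀ {n m} (G : Graph n m) {w k ρ} →
  OPT G w k <∞ ρ → mincut G (trunc w ρ) <∞ (ℕ→ℚ k * ρ)
OPT<∞ρ⇒mincut-trunc<∞k*ρ G {w} {k} OPT<ρ with OPT<∞⇒∃cut G {w} {k} OPT<ρ
... | C , C∈ , val<ρ with val<∞⇒valF<∞ {w = w} {k} val<ρ
... | F , valF<ρ = cut<⇒mincut<∞ G C∈ (valF<∞⇒wt-trunc<k*ρ F valF<ρ)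

≤∞OPT⇒k*q≤∞mincut-trunc : ∀ {n m} (G : Graph n m) {w : Fin m → ℚ} → (∀ e → 0ℚ Q.≤ w e) →
  ∀ {k ρ q} → 0ℚ Q.≤ ρ → q Q.≤ ρ → q ≤∞ OPT G w k → (ℕ→ℚ k * q) ≤∞ mincut G (trunc w ρ)
≤∞OPT⇒k*q≤∞mincut-trunc G {w} w≥0 {ρ = ρ} ρ≥0 q≤ρ q≤OPT = ≤cuts⇒≤∞mincut G λ {C} C∈ →
  ≤∞valF-heavy⇒k*q≤wt-trunc w≥0 ρ≥0 C q≤ρ (≤∞val⇒≤∞valF (heavy w ρ ∩ C) (≤∞OPT⇒≤∞val G q≤OPT C∈))

theorem2p10 : (n m : ℕ) (G : Graph n m) (w : Fin m → ℚ) → (∀ e → 0ℚ Q.≤ w e) →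
    (k : ℕ) → 1 ≤ k → (lam γ : ℚ) → 0ℚ < lam → (γ>0 : 0ℚ < γ) →
    let ρ = (1ℚ + γ) * lam in
    ((lam ≤∞ OPT G w k) × (OPT G w k <∞ ρ) →
       (_÷_ (ℕ→ℚ k * ρ) (1ℚ + γ) {{1+γ-nz γ>0}} ≤∞ mincut G (trunc w ρ))
       × (mincut G (trunc w ρ) <∞ (ℕ→ℚ k * ρ)))
    × ((S : Subset n) → ProperSide S → wt (trunc w ρ) (δ G S) < ℕ→ℚ k * ρ →
       (valF w k (δ G S) (heavy w ρ ∩ δ G S) <∞ ρ) × (val w k (δ G S) <∞ ρ))
theorem2p10 n m G w w≥0 k _ lam γ lam>0 γ>0 =
    (λ (lam≤OPT , OPT<ρ) →
         subst (_≤∞ mincut G (trunc w ρ)) (sym (p*[r*q]÷r≡p*q (ℕ→ℚ k) lam (1ℚ + γ) {{1+γ-nz γ>0}}))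
           (≤∞OPT⇒k*q≤∞mincut-trunc G w≥0 ρ≥0 lam≤ρ lam≤OPT)
       , OPT<∞ρ⇒mincut-trunc<∞k*ρ G OPT<ρ)
  , λ S _ wρ[δS]<kρ →
      let valF<ρ = wt-trunc<k*ρ⇒valF-heavy<∞ρ w≥0 ρ≥0 (δ G S) wρ[δS]<kρ in valF<ρ , valF<∞⇒val<∞ valF<ρ
  where
  ρ : ℚ
  ρ = (1ℚ + γ) * lam

  lam≤ρ : lam Q.≤ ρ
  lam≤ρ = p≤[1+q]*p (<⇒≤ lam>0) (<⇒≤ γ>0)

  ρ≥0 : 0ℚ Q.≤ ρ
  ρ≥0 = ≤-trans (<⇒≤ lam>0) lam≤ρ
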